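{- Let $\mathbb{F}$ be a field, $D=(X,E,s,t)$ a finite directed multigraph, $U$ an $\mathbb{F}$-vector space, $\phi:X\to U$ a map, and $T\subset E$ a spanning forest of $D$. Let $\{r_1,\dots,r_{\delta_\phi}\}$ be any $\mathbb{F}$-basis of $\mathcal{Z}_{\mathrm{alg}}:=\mathrm{Im}(B_D)\cap\mathrm{Ker}(\hat\phi)$, and let $\zeta_{r_1},\dots,\zeta_{r_{\delta_\phi}}\in\mathrm{Ker}(\partial_\phi)$ be lifts satisfying $B_D(\zeta_{r_i})=r_i$ (such lifts exist). Then $$\{Z_e^{(\mathrm{top})}\}_{e\in E\setminus T}\cup\{\zeta_{r_1},\dots,\zeta_{r_{\delta_\phi}}\}$$ is an $\mathbb{F}$-basis of $\mathrm{Ker}(\partial_\phi)$.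
   Context: $B_D(\mathbf{1}_e)=\mathbf{1}_{t(e)}-\mathbf{1}_{s(e)}$; $\hat\phi(\mathbf{1}_x)=\phi(x)$; $\partial_\phi(\mathbf{1}_e)=\phi(t(e))-\phi(s(e))$; $\delta_\phi=\dim\mathcal{Z}_{\mathrm{alg}}$; $c(D)$ = number of weakly connected components. A spanning forest is a subset $T\subset E$ whose underlying undirected graph has no cycle and $|T|=|X|-c(D)$. For vertices $a,b$ in the same component, let $a=y_0,\dots,y_m=b$ be the unique simple path in $T$, $g_k\in T$ the edge joining $y_{k-1},y_k$, $\eta_k=+1$ if $s(g_k)=y_{k-1}$ and $-1$ if $s(g_k)=y_k$; the signed path vector is $F[a,b]=\sum_k\eta_k\mathbf{1}_{g_k}$ ($F[a,a]=0$). For $e\in E\setminus T$, $Z_e^{(\mathrm{top})}:=\mathbf{1}_e-F[s(e),t(e)]$. -}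

module Defs where

open import Level using (Level; _⊔_; suc)
open import Data.Nat using (ℕ; _≤_)
import Data.Nat as ℕ
open import Data.Fin using (Fin; _≟_)
import Data.Fin as Fin
open import Data.Fin.Subset using (Subset; _∈_; _∉_; ∣_∣)
open import Data.List using (List; []; _∷_; length; lookup)
open import Data.List.Relation.Unary.All using (All)
open import Data.List.Relation.Unary.Unique.Propositional using (Unique)
open import Data.Product using (Σ; ∃; _×_; _,_)
open import Data.Bool using (if_then_else_)
open import Relation.Nullary using (¬_)
open import Relation.Nullary.Decidable using (⌊_⌋)
open import Relation.Binary.PropositionalEquality using (_≡_)
open import Function.Bundles using (_⇔_)
open import Function.Definitions using (Surjective)
open import Algebra.Bundles using (CommutativeRing)
open import Algebra.Module.Bundles using (Module)

record Field (c ℓ : Level) : Set (suc (c ⊔ ℓ)) where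
  field
    commutativeRing : CommutativeRing c ℓ
  open CommutativeRing commutativeRing public
  field
    0≉1 : ¬ (0# ≈ 1#)
    inverse : ∀ x → ¬ (x ≈ 0#) → ∃ λ y → x * y ≈ 1#

record Digraph : Set where
  field
    nV nE : ℕ
    s t : Fin nE → Fin nV

module Graph (D : Digraph) where
  open Digraph D

  -- Undirected walks in the underlying graph, each step recording the
  -- orientation in which the edge is traversed:
  --   fwd e : from s(e) to t(e)   (η = +1)
  --   bwd e : from t(e) to s(e)   (η = -1)
  data Walk : Fin nV → Fin nV → Set where
    []  : ∀ {a} → Walk a a
    fwd : ∀ {b} (e : Fin nE) → Walk (t e) b → Walk (s e) b
    bwd : ∀ {b} (e : Fin nE) → Walk (s e) b → Walk (t e) b

  verts : ∀ {a b} → Walk a b → List (Fin nV)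
  verts {a} []        = a ∷ []
  verts {a} (fwd e w) = a ∷ verts w
  verts {a} (bwd e w) = a ∷ verts w

  tailVerts : ∀ {a b} → Walk a b → List (Fin nV)
  tailVerts []        = []
  tailVerts (fwd e w) = verts w
  tailVerts (bwd e w) = verts w

  edges : ∀ {a b} → Walk a b → List (Fin nE)
  edges []        = []
  edges (fwd e w) = e ∷ edges w
  edges (bwd e w) = e ∷ edges w

  InSub : ∀ {a b} → Subset nE → Walk a b → Set
  InSub T w = All (_∈ T) (edges w)

  IsSimplePath : ∀ {a b} → Walk a b → Set
  IsSimplePath w = Unique (verts w)

  -- cycle: nonempty closed walk, no repeated edge, no repeated vertex
  -- other than start = end
  IsCycle : ∀ {a} → Walk a a → Set
  IsCycle w = (1 ≤ length (edges w)) × Unique (edges w) × Unique (tailVerts w)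

  Acyclic : Subset nE → Set
  Acyclic T = ¬ (Σ (Fin nV) λ a → Σ (Walk a a) λ w → InSub T w × IsCycle w)

  Connected : Fin nV → Fin nV → Set
  Connected a b = Walk a b

  -- c(D) = k : the weakly connected components are exactly the fibres of a
  -- surjection X → Fin k
  NumComponents : ℕ → Set
  NumComponents k =
    Σ (Fin nV → Fin k) λ comp →
      Surjective _≡_ _≡_ comp × (∀ x y → (comp x ≡ comp y) ⇔ Connected x y)

  IsSpanningForest : Subset nE → Set
  IsSpanningForest T =
    Acyclic T × Σ ℕ λ k → NumComponents k × (∣ T ∣ ℕ.+ k ≡ nV)

module Linear {c ℓ} (F : Field c ℓ) where
  open Field F

  Vecᶠ : ℕ → Set c
  Vecᶠ k = Fin k → Carrier

  _≈ᵛ_ : ∀ {k} → Vecᶠ k → Vecᶠ k → Set ℓ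
  u ≈ᵛ v = ∀ i → u i ≈ v i

  0ᵛ : ∀ {k} → Vecᶠ k
  0ᵛ _ = 0#

  _+ᵛ_ : ∀ {k} → Vecᶠ k → Vecᶠ k → Vecᶠ k
  (u +ᵛ v) i = u i + v i

  _-ᵛ_ : ∀ {k} → Vecᶠ k → Vecᶠ k → Vecᶠ k
  (u -ᵛ v) i = u i - v i

  _·ᵛ_ : ∀ {k} → Carrier → Vecᶠ k → Vecᶠ k
  (a ·ᵛ v) i = a * v i

  𝟙 : ∀ {k} → Fin k → Vecᶠ k
  𝟙 x y = if ⌊ x ≟ y ⌋ then 1# else 0#

  Σ[_] : ∀ {k} → (Fin k → Carrier) → Carrier
  Σ[_] {ℕ.zero}  f = 0#
  Σ[_] {ℕ.suc k} f = f Fin.zero + Σ[ (λ i → f (Fin.suc i)) ]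

  lincomb : ∀ {k} (L : List (Vecᶠ k)) → (Fin (length L) → Carrier) → Vecᶠ k
  lincomb L a x = Σ[ (λ i → a i * lookup L i x) ]

  LinIndep : ∀ {k} → List (Vecᶠ k) → Set (c ⊔ ℓ)
  LinIndep L = ∀ a → lincomb L a ≈ᵛ 0ᵛ → ∀ i → a i ≈ 0#

  Spans : ∀ {k p} → (Vecᶠ k → Set p) → List (Vecᶠ k) → Set (c ⊔ ℓ ⊔ p)
  Spans W L = ∀ v → W v → ∃ λ a → v ≈ᵛ lincomb L a

  IsBasisOf : ∀ {k p} → (Vecᶠ k → Set p) → List (Vecᶠ k) → Set (c ⊔ ℓ ⊔ p)
  IsBasisOf W L = All W L × LinIndep L × Spans W L

  module OnGraph (D : Digraph) where
    open Digraph D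
    open Graph D

    B : Vecᶠ nE → Vecᶠ nV
    B w x = Σ[ (λ e → w e * (𝟙 (t e) x - 𝟙 (s e) x)) ]

    ImB : Vecᶠ nV → Set (c ⊔ ℓ)
    ImB y = ∃ λ w → B w ≈ᵛ y

    signedVec : ∀ {a b} → Walk a b → Vecᶠ nE
    signedVec []        = 0ᵛ
    signedVec (fwd e w) = 𝟙 e +ᵛ signedVec w
    signedVec (bwd e w) = signedVec w -ᵛ 𝟙 e

    -- Z : E → F^E agrees, on every edge e ∉ T, with
    -- Z_e^(top) = 1_e - F[s(e), t(e)], F computed along the simple T-path.
    IsZtop : Subset nE → (Fin nE → Vecᶠ nE) → Set ℓ
    IsZtop T Z = ∀ e → e ∉ T →
      Σ (Walk (s e) (t e)) λ p →
        InSub T p × IsSimplePath p × (Z e ≈ᵛ (𝟙 e -ᵛ signedVec p))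

    module WithU {m ℓm} (U : Module commutativeRing m ℓm) where
      open Module U

      ΣU[_] : ∀ {k} → (Fin k → Carrierᴹ) → Carrierᴹ
      ΣU[_] {ℕ.zero}  f = 0ᴹ
      ΣU[_] {ℕ.suc k} f = f Fin.zero +ᴹ ΣU[ (λ i → f (Fin.suc i)) ]

      φ̂ : (Fin nV → Carrierᴹ) → Vecᶠ nV → Carrierᴹ
      φ̂ φ y = ΣU[ (λ x → y x *ₗ φ x) ]

      ∂ : (Fin nV → Carrierᴹ) → Vecᶠ nE → Carrierᴹ
      ∂ φ z = ΣU[ (λ e → z e *ₗ (φ (t e) +ᴹ (-ᴹ φ (s e)))) ]

      Ker∂ : (Fin nV → Carrierᴹ) → Vecᶠ nE → Set ℓm
      Ker∂ φ z = ∂ φ z ≈ᴹ 0ᴹ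

      Zalg : (Fin nV → Carrierᴹ) → Vecᶠ nV → Set (c ⊔ ℓ ⊔ ℓm)
      Zalg φ y = ImB y × (φ̂ φ y ≈ᴹ 0ᴹ)

module Submission where

-- ∂_φ = φ̂ ∘ B, so Ker ∂_φ is the preimage of Z_alg under B and contains ker B. Hence a basis
-- of ker B together with lifts ζ_i of a basis r_i of Z_alg is a basis of Ker ∂_φ. The
-- fundamental cycles Z_e (e ∉ T) lie in ker B and Z_e(e′) = δ_{ee′} for e, e′ ∉ T, so they
-- are independent; and u ∈ ker B minus Σ_{e ∉ T} u(e) Z_e is a vector of ker B supported
-- on the forest T. Such a vector vanishes: a nonempty forest has a leaf x whose only forest
-- edge g gives (Bw)(x) = ±w(g), so w(g) = 0 and g can be removed.

open import Defs
open import Level using (Level; _⊔_)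
open import Data.Nat using (ℕ; zero; suc; _≤_; _<_; z≤n; s≤s)
open import Data.Nat.Properties using (≤-refl; <-≤-trans; +-suc; <⇒≱; m≤m+n; n≮0; ≤-pred)
open import Data.Fin using (Fin; zero; suc; _≟_; punchIn; cast)
open import Data.Fin.Properties using (punchInᵢ≢i; cast-involutive; any?)
open import Data.Fin.Subset using (Subset; _∈_; _∉_; _⊆_; ∣_∣; ⁅_⁆) renaming (_-_ to _∖_)
open import Data.Fin.Subset.Properties using (_∈?_; x∈p⇒∣p-x∣<∣p∣; x∈p∧x≢y⇒x∈p-y; p─q⊆p)
open import Data.List using (List; []; _∷_; map; filter; allFin; tabulate; _++_; length; lookup)
open import Data.List.Properties using (length-tabulate)
open import Data.List.Relation.Unary.All as All using (All; []; _∷_)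
import Data.List.Relation.Unary.All.Properties as AllP
open import Data.List.Relation.Unary.All.Properties using (¬Any⇒All¬; All¬⇒¬Any)
open import Data.List.Relation.Unary.Any as Any using (here; there)
open import Data.List.Relation.Unary.AllPairs using ([]; _∷_)
open import Data.List.Relation.Unary.Unique.Propositional using (Unique)
import Data.List.Relation.Unary.Unique.Propositional.Properties as Unique
open import Data.List.Membership.Propositional using () renaming (_∈_ to _∈ₗ_; _∉_ to _∉ₗ_)
open import Data.List.Membership.Propositional.Properties using (∈-lookup; ∈-filter⁺; ∈-allFin)
import Data.List.Membership.DecPropositional
open import Data.Vec.Functional using (replicate)
open import Data.Product using (∃; ∃₂; _×_; _,_; proj₁; proj₂)
open import Data.Sum using (_⊎_; inj₁; inj₂)
open import Function using (_∘_)
open import Relation.Nullary using (¬_; Dec; yes; no; contradiction)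
open import Relation.Nullary.Decidable using (¬?; _⊎-dec_; _×-dec_; decidable-stable)
open import Relation.Binary.PropositionalEquality as ≡ using (_≡_; _≢_)
open import Algebra.Module.Bundles using (Module)
open import Algebra.Module.Construct.TensorUnit using (⟨module⟩)

module Coordinates {c ℓ} (F : Field c ℓ) where
  open Field F hiding (zero)
  open Linear F

  𝟙-diag : ∀ {k} (x : Fin k) → 𝟙 x x ≈ 1#
  𝟙-diag x with x ≟ x
  ... | yes _   = refl
  ... | no x≢x = contradiction ≡.refl x≢x

  𝟙-off : ∀ {k} {x y : Fin k} → x ≢ y → 𝟙 x y ≈ 0#
  𝟙-off {x = x} {y} x≢y with x ≟ y
  ... | yes x≡y = contradiction x≡y x≢y
  ... | no _    = refl

  -- lincomb L is definitionally lincombᶠ (lookup L), and B is lincombᶠ column (see IncidenceMap).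
  lincombᶠ : ∀ {n k} → (Fin n → Vecᶠ k) → Vecᶠ n → Vecᶠ k
  lincombᶠ v b x = Σ[ (λ i → b i * v i x) ]

-- Σ′ is any summation obeying the defining equations of the library's sum; it is instantiated
-- with Σ[_] (F as a module over itself) and with ΣU[_].
module Combinations {c ℓ} (F : Field c ℓ) {m ℓm}
  (M : Module (Field.commutativeRing F) m ℓm)
  (Σ′ : ∀ {k} → (Fin k → Module.Carrierᴹ M) → Module.Carrierᴹ M)
  (Σ′-zero : ∀ f → Σ′ {0} f ≡ Module.0ᴹ M)
  (Σ′-suc : ∀ {k} f → Σ′ {suc k} f ≡ Module._+ᴹ_ M (f zero) (Σ′ (λ i → f (suc i))))
  where

  open Module M
  open Field F hiding (zero)
  open Linear F
  open Coordinates F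
  open import Algebra.Properties.CommutativeMonoid.Sum +ᴹ-commutativeMonoid
  open import Algebra.Properties.Group +ᴹ-group using (inverseʳ-unique)
  open import Relation.Binary.Reasoning.Setoid ≈ᴹ-setoid

  private
    Σ′≡sum : ∀ {k} (f : Fin k → Carrierᴹ) → Σ′ f ≡ sum f
    Σ′≡sum {zero}  f = Σ′-zero f
    Σ′≡sum {suc k} f = ≡.trans (Σ′-suc f) (≡.cong (f zero +ᴹ_) (Σ′≡sum (λ i → f (suc i))))

  Σ-cong : ∀ {k} {f g : Fin k → Carrierᴹ} → (∀ i → f i ≈ᴹ g i) → Σ′ f ≈ᴹ Σ′ g
  Σ-cong {f = f} {g} f≈g = begin
    Σ′ f   ≡⟨ Σ′≡sum f ⟩
    sum f  ≈⟨ sum-cong-≋ f≈g ⟩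
    sum g  ≡⟨ Σ′≡sum g ⟨
    Σ′ g   ∎

  Σ-zero : ∀ {k} {f : Fin k → Carrierᴹ} → (∀ i → f i ≈ᴹ 0ᴹ) → Σ′ f ≈ᴹ 0ᴹ
  Σ-zero {k} {f} f≈0 = begin
    Σ′ f                  ≡⟨ Σ′≡sum f ⟩
    sum f                 ≈⟨ sum-cong-≋ f≈0 ⟩
    sum (replicate k 0ᴹ)  ≈⟨ sum-replicate-zero k ⟩
    0ᴹ                    ∎

  Σ-distrib-+ : ∀ {k} (f g : Fin k → Carrierᴹ) → Σ′ (λ i → f i +ᴹ g i) ≈ᴹ Σ′ f +ᴹ Σ′ g
  Σ-distrib-+ f g = begin
    Σ′ (λ i → f i +ᴹ g i)   ≡⟨ Σ′≡sum _ ⟩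
    sum (λ i → f i +ᴹ g i)  ≈⟨ ∑-distrib-+ f g ⟩
    sum f +ᴹ sum g          ≡⟨ ≡.cong₂ _+ᴹ_ (Σ′≡sum f) (Σ′≡sum g) ⟨
    Σ′ f +ᴹ Σ′ g            ∎

  Σ-single : ∀ {k} (f : Fin k → Carrierᴹ) j → (∀ i → i ≢ j → f i ≈ᴹ 0ᴹ) → Σ′ f ≈ᴹ f j
  Σ-single {suc k} f j f≈0 = begin
    Σ′ f                                ≡⟨ Σ′≡sum f ⟩
    sum f                               ≈⟨ sum-remove f ⟩
    f j +ᴹ sum (λ i → f (punchIn j i))  ≈⟨ +ᴹ-congˡ (sum-cong-≋ (λ i → f≈0 _ (punchInᵢ≢i j i))) ⟩
    f j +ᴹ sum (replicate k 0ᴹ)         ≈⟨ +ᴹ-congˡ (sum-replicate-zero k) ⟩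
    f j +ᴹ 0ᴹ                           ≈⟨ +ᴹ-identityʳ (f j) ⟩
    f j                                 ∎

  *ₗ-distrib-Σ : ∀ {k} a (f : Fin k → Carrierᴹ) → a *ₗ Σ′ f ≈ᴹ Σ′ (λ i → a *ₗ f i)
  *ₗ-distrib-Σ {zero} a f = begin
    a *ₗ Σ′ f  ≡⟨ ≡.cong (a *ₗ_) (Σ′-zero f) ⟩
    a *ₗ 0ᴹ    ≈⟨ *ₗ-zeroʳ a ⟩
    0ᴹ         ≡⟨ Σ′-zero _ ⟨
    Σ′ _       ∎
  *ₗ-distrib-Σ {suc k} a f = begin
    a *ₗ Σ′ f                                 ≡⟨ ≡.cong (a *ₗ_) (Σ′-suc f) ⟩
    a *ₗ (f zero +ᴹ Σ′ (λ i → f (suc i)))     ≈⟨ *ₗ-distribˡ a _ _ ⟩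
    a *ₗ f zero +ᴹ a *ₗ Σ′ (λ i → f (suc i))  ≈⟨ +ᴹ-congˡ (*ₗ-distrib-Σ a (λ i → f (suc i))) ⟩
    a *ₗ f zero +ᴹ Σ′ (λ i → a *ₗ f (suc i))  ≡⟨ Σ′-suc _ ⟨
    Σ′ (λ i → a *ₗ f i)                       ∎

  -1*ₗx≈-x : ∀ x → (- 1#) *ₗ x ≈ᴹ -ᴹ x
  -1*ₗx≈-x x = inverseʳ-unique x ((- 1#) *ₗ x) (begin
    x +ᴹ (- 1#) *ₗ x          ≈⟨ +ᴹ-congʳ (*ₗ-identityˡ x) ⟨
    1# *ₗ x +ᴹ (- 1#) *ₗ x    ≈⟨ *ₗ-distribʳ x 1# (- 1#) ⟨
    (1# - 1#) *ₗ x            ≈⟨ *ₗ-congʳ (-‿inverseʳ 1#) ⟩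
    0# *ₗ x                   ≈⟨ *ₗ-zeroˡ x ⟩
    0ᴹ                        ∎)

  lincombᴹ : ∀ {n} → (Fin n → Carrierᴹ) → Vecᶠ n → Carrierᴹ
  lincombᴹ v b = Σ′ (λ i → b i *ₗ v i)

  record IsLinear {k} (g : Vecᶠ k → Carrierᴹ) : Set (c ⊔ ℓ ⊔ ℓm) where
    field
      cong    : ∀ {u v} → u ≈ᵛ v → g u ≈ᴹ g v
      +-homo  : ∀ u v → g (u +ᵛ v) ≈ᴹ g u +ᴹ g v
      *ₗ-homo : ∀ a u → g (a ·ᵛ u) ≈ᴹ a *ₗ g u

    0-homo : g 0ᵛ ≈ᴹ 0ᴹ
    0-homo = begin
      g 0ᵛ            ≈⟨ cong (λ _ → zeroˡ 0#) ⟨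
      g (0# ·ᵛ 0ᵛ)    ≈⟨ *ₗ-homo 0# 0ᵛ ⟩
      0# *ₗ g 0ᵛ      ≈⟨ *ₗ-zeroˡ _ ⟩
      0ᴹ              ∎

    -‿homo : ∀ u v → g (u -ᵛ v) ≈ᴹ g u +ᴹ -ᴹ g v
    -‿homo u v = begin
      g (u -ᵛ v)                ≈⟨ cong (λ x → +-congˡ (-1*x≈-x (v x))) ⟨
      g (u +ᵛ ((- 1#) ·ᵛ v))    ≈⟨ +-homo u _ ⟩
      g u +ᴹ g ((- 1#) ·ᵛ v)    ≈⟨ +ᴹ-congˡ (*ₗ-homo (- 1#) v) ⟩
      g u +ᴹ (- 1#) *ₗ g v      ≈⟨ +ᴹ-congˡ (-1*ₗx≈-x (g v)) ⟩
      g u +ᴹ -ᴹ g v             ∎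
      where open import Algebra.Properties.Ring ring using (-1*x≈-x)

    lincombᶠ-homo : ∀ {n} (v : Fin n → Vecᶠ k) b → g (lincombᶠ v b) ≈ᴹ lincombᴹ (λ i → g (v i)) b
    lincombᶠ-homo {zero} v b = ≈ᴹ-trans 0-homo (≈ᴹ-reflexive (≡.sym (Σ′-zero _)))
    lincombᶠ-homo {suc n} v b = begin
      g ((b zero ·ᵛ v zero) +ᵛ lincombᶠ (v ∘ suc) (b ∘ suc))
        ≈⟨ +-homo _ _ ⟩
      g (b zero ·ᵛ v zero) +ᴹ g (lincombᶠ (v ∘ suc) (b ∘ suc))
        ≈⟨ +ᴹ-cong (*ₗ-homo (b zero) (v zero)) (lincombᶠ-homo (v ∘ suc) (b ∘ suc)) ⟩
      b zero *ₗ g (v zero) +ᴹ lincombᴹ (λ i → g (v (suc i))) (b ∘ suc)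
        ≡⟨ Σ′-suc _ ⟨
      lincombᴹ (λ i → g (v i)) b
        ∎

  lincombᴹ-linear : ∀ {n} (v : Fin n → Carrierᴹ) → IsLinear (lincombᴹ v)
  lincombᴹ-linear v = record
    { cong    = λ a≈b → Σ-cong (λ i → *ₗ-congʳ (a≈b i))
    ; +-homo  = λ a b → ≈ᴹ-trans (Σ-cong (λ i → *ₗ-distribʳ (v i) (a i) (b i))) (Σ-distrib-+ _ _)
    ; *ₗ-homo = λ x a → ≈ᴹ-trans (Σ-cong (λ i → *ₗ-assoc x (a i) (v i))) (≈ᴹ-sym (*ₗ-distrib-Σ x _))
    }

  lincombᴹ-𝟙 : ∀ {n} (v : Fin n → Carrierᴹ) i → lincombᴹ v (𝟙 i) ≈ᴹ v i
  lincombᴹ-𝟙 v i = begin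
    lincombᴹ v (𝟙 i)  ≈⟨ Σ-single _ i off-diagonal ⟩
    𝟙 i i *ₗ v i      ≈⟨ *ₗ-congʳ (𝟙-diag i) ⟩
    1# *ₗ v i         ≈⟨ *ₗ-identityˡ _ ⟩
    v i               ∎
    where
    off-diagonal : ∀ j → j ≢ i → 𝟙 i j *ₗ v j ≈ᴹ 0ᴹ
    off-diagonal j j≢i = ≈ᴹ-trans (*ₗ-congʳ (𝟙-off (j≢i ∘ ≡.sym))) (*ₗ-zeroˡ _)

  lincombᴹ-of-zeros : ∀ {n} {v : Fin n → Carrierᴹ} b → (∀ i → v i ≈ᴹ 0ᴹ) → lincombᴹ v b ≈ᴹ 0ᴹ
  lincombᴹ-of-zeros b v≈0 = Σ-zero (λ i → ≈ᴹ-trans (*ₗ-congˡ (v≈0 i)) (*ₗ-zeroʳ (b i)))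

module LinearAlgebra {c ℓ} (F : Field c ℓ) where
  open Field F hiding (zero)
  open Linear F
  open Coordinates F public
  open Combinations F ⟨module⟩ Σ[_] (λ _ → ≡.refl) (λ _ → ≡.refl) public
  open import Algebra.Properties.Group +-group using (//-rightDividesˡ)
  open import Relation.Binary.Reasoning.Setoid setoid

  IsLinearᵛ : ∀ {k m} → (Vecᶠ k → Vecᶠ m) → Set (c ⊔ ℓ)
  IsLinearᵛ f = ∀ x → IsLinear (λ u → f u x)

  lincombᶠ-linear : ∀ {n k} (v : Fin n → Vecᶠ k) → IsLinearᵛ (lincombᶠ v)
  lincombᶠ-linear v x = lincombᴹ-linear (λ i → v i x)

  lincomb-cong : ∀ {k} (L : List (Vecᶠ k)) {a b} → (∀ i → a i ≈ b i) → lincomb L a ≈ᵛ lincomb L b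
  lincomb-cong L a≈b x = IsLinear.cong (lincombᶠ-linear (lookup L) x) a≈b

  lincomb-vanishes-at : ∀ {k} {L : List (Vecᶠ k)} x → All (λ v → v x ≈ 0#) L → ∀ a → lincomb L a x ≈ 0#
  lincomb-vanishes-at x L[x]≈0 a = lincombᴹ-of-zeros a (λ i → All.lookup L[x]≈0 (∈-lookup i))

  lincomb-∈-kernel : ∀ {k m} {f : Vecᶠ k → Vecᶠ m} → IsLinearᵛ f → ∀ {L} →
                     All (λ v → f v ≈ᵛ 0ᵛ) L → ∀ a → f (lincomb L a) ≈ᵛ 0ᵛ
  lincomb-∈-kernel f-linear {L} L⊆ker a x =
    trans (IsLinear.lincombᶠ-homo (f-linear x) (lookup L) a)
          (lincombᴹ-of-zeros a (λ i → All.lookup L⊆ker (∈-lookup i) x))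

  -- length (tabulate v) is only propositionally equal to n, hence the casts.
  module _ {a} {A : Set a} {n} (v : Fin n → A) where

    tabulate-index : Fin n → Fin (length (tabulate v))
    tabulate-index = cast (≡.sym (length-tabulate v))

    tabulate-index⁻¹ : Fin (length (tabulate v)) → Fin n
    tabulate-index⁻¹ = cast (length-tabulate v)

    tabulate-index-inverseˡ : ∀ j → tabulate-index (tabulate-index⁻¹ j) ≡ j
    tabulate-index-inverseˡ = cast-involutive (≡.sym (length-tabulate v)) (length-tabulate v)

    tabulate-index-inverseʳ : ∀ i → tabulate-index⁻¹ (tabulate-index i) ≡ i
    tabulate-index-inverseʳ = cast-involutive (length-tabulate v) (≡.sym (length-tabulate v))

  tabulate-index-zero : ∀ {a} {A : Set a} {n} (v : Fin n → A) {b} →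
                        (∀ i → b (tabulate-index v i) ≈ 0#) → ∀ j → b j ≈ 0#
  tabulate-index-zero v {b} b≈0 j = begin
    b j                                           ≡⟨ ≡.cong b (tabulate-index-inverseˡ v j) ⟨
    b (tabulate-index v (tabulate-index⁻¹ v j))   ≈⟨ b≈0 _ ⟩
    0#                                            ∎

  lincomb-tabulate : ∀ {n k} (v : Fin n → Vecᶠ k) a →
                     lincomb (tabulate v) a ≈ᵛ lincombᶠ v (a ∘ tabulate-index v)
  lincomb-tabulate {zero}  v a x = refl
  lincomb-tabulate {suc n} v a x = +-congˡ (lincomb-tabulate (v ∘ suc) (a ∘ suc) x)

  lincombᶠ-as-tabulate : ∀ {n k} (v : Fin n → Vecᶠ k) b →
                         lincombᶠ v b ≈ᵛ lincomb (tabulate v) (b ∘ tabulate-index⁻¹ v)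
  lincombᶠ-as-tabulate v b x = sym (begin
    lincomb (tabulate v) (b ∘ tabulate-index⁻¹ v) x
      ≈⟨ lincomb-tabulate v _ x ⟩
    lincombᶠ v (b ∘ tabulate-index⁻¹ v ∘ tabulate-index v) x
      ≈⟨ IsLinear.cong (lincombᶠ-linear v x) (reflexive ∘ ≡.cong b ∘ tabulate-index-inverseʳ v) ⟩
    lincombᶠ v b x
      ∎)

  tabulate-independent : ∀ {n k} (v : Fin n → Vecᶠ k) → LinIndep (tabulate v) →
                         ∀ b → lincombᶠ v b ≈ᵛ 0ᵛ → ∀ i → b i ≈ 0#
  tabulate-independent v independent b vb≈0 i = begin
    b i                                           ≡⟨ ≡.cong b (tabulate-index-inverseʳ v i) ⟨
    b (tabulate-index⁻¹ v (tabulate-index v i))   ≈⟨ independent _ vb≈0′ _ ⟩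
    0#                                            ∎
    where
    vb≈0′ : lincomb (tabulate v) (b ∘ tabulate-index⁻¹ v) ≈ᵛ 0ᵛ
    vb≈0′ x = trans (sym (lincombᶠ-as-tabulate v b x)) (vb≈0 x)

  tabulate-spans : ∀ {n k p} {W : Vecᶠ k → Set p} (v : Fin n → Vecᶠ k) → Spans W (tabulate v) →
                   ∀ w → W w → ∃ λ b → w ≈ᵛ lincombᶠ v b
  tabulate-spans v spans w w∈W with a , w≈va ← spans w w∈W =
    a ∘ tabulate-index v , λ x → trans (w≈va x) (lincomb-tabulate v a x)

  join : ∀ {a} {A : Set a} (L₁ : List A) {L₂ : List A} →
         Vecᶠ (length L₁) → Vecᶠ (length L₂) → Vecᶠ (length (L₁ ++ L₂))
  join []       a₁ a₂         = a₂
  join (_ ∷ L₁) a₁ a₂ zero    = a₁ zero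
  join (_ ∷ L₁) a₁ a₂ (suc j) = join L₁ (a₁ ∘ suc) a₂ j

  join-surjective : ∀ {a} {A : Set a} (L₁ : List A) {L₂ : List A} (b : Vecᶠ (length (L₁ ++ L₂))) →
                    ∃₂ λ a₁ a₂ → ∀ j → b j ≡ join L₁ a₁ a₂ j
  join-surjective []       b = (λ ()) , b , λ _ → ≡.refl
  join-surjective (_ ∷ L₁) b with a₁ , a₂ , b∘suc≡join ← join-surjective L₁ (b ∘ suc) =
    (λ { zero → b zero ; (suc i) → a₁ i }) , a₂ , λ { zero → ≡.refl ; (suc j) → b∘suc≡join j }

  join-zero : ∀ {a} {A : Set a} (L₁ : List A) {L₂ : List A} {a₁ a₂} →
              (∀ i → a₁ i ≈ 0#) → (∀ i → a₂ i ≈ 0#) → ∀ j → join L₁ {L₂} a₁ a₂ j ≈ 0#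
  join-zero []       a₁≈0 a₂≈0 j       = a₂≈0 j
  join-zero (_ ∷ L₁) a₁≈0 a₂≈0 zero    = a₁≈0 zero
  join-zero (_ ∷ L₁) a₁≈0 a₂≈0 (suc j) = join-zero L₁ (a₁≈0 ∘ suc) a₂≈0 j

  lincomb-++ : ∀ {k} (L₁ L₂ : List (Vecᶠ k)) a₁ a₂ →
               lincomb (L₁ ++ L₂) (join L₁ a₁ a₂) ≈ᵛ (lincomb L₁ a₁ +ᵛ lincomb L₂ a₂)
  lincomb-++ []       L₂ a₁ a₂ x = sym (+-identityˡ _)
  lincomb-++ (v ∷ L₁) L₂ a₁ a₂ x = trans (+-congˡ (lincomb-++ L₁ L₂ (a₁ ∘ suc) a₂ x)) (sym (+-assoc _ _ _))

  module KernelExtension {k m p q} {f : Vecᶠ k → Vecᶠ m} (f-linear : IsLinearᵛ f)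
    {K : Vecᶠ k → Set p} {W : Vecᶠ m → Set q}
    (f[K]⊆W : ∀ {v} → K v → W (f v)) (ker⊆K : ∀ {v} → f v ≈ᵛ 0ᵛ → K v)
    {L : List (Vecᶠ k)} (L-basis : IsBasisOf (λ v → f v ≈ᵛ 0ᵛ) L)
    {n} {r : Fin n → Vecᶠ m} (r-basis : IsBasisOf W (tabulate r))
    {ζ : Fin n → Vecᶠ k} (ζ∈K : ∀ i → K (ζ i)) (fζ≈r : ∀ i → f (ζ i) ≈ᵛ r i)
    where

    private
      module f x = IsLinear (f-linear x)
      module ζ x = IsLinear (lincombᶠ-linear ζ x)

      L⊆ker = proj₁ L-basis
      L-independent = proj₁ (proj₂ L-basis)
      L-spans = proj₂ (proj₂ L-basis)

      f-lincombᶠ-ζ : ∀ b → f (lincombᶠ ζ b) ≈ᵛ lincombᶠ r b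
      f-lincombᶠ-ζ b x = trans (f.lincombᶠ-homo x ζ b) (Σ-cong (λ i → *-congˡ (fζ≈r i x)))

    independent : ∀ a b → (lincomb L a +ᵛ lincombᶠ ζ b) ≈ᵛ 0ᵛ → (∀ i → a i ≈ 0#) × (∀ i → b i ≈ 0#)
    independent a b La+ζb≈0 = L-independent a La≈0 , b≈0
      where
      rb≈0 : lincombᶠ r b ≈ᵛ 0ᵛ
      rb≈0 x = begin
        lincombᶠ r b x                           ≈⟨ f-lincombᶠ-ζ b x ⟨
        f (lincombᶠ ζ b) x                       ≈⟨ +-identityˡ _ ⟨
        0# + f (lincombᶠ ζ b) x                  ≈⟨ +-congʳ (lincomb-∈-kernel f-linear L⊆ker a x) ⟨
        f (lincomb L a) x + f (lincombᶠ ζ b) x   ≈⟨ f.+-homo x _ _ ⟨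
        f (lincomb L a +ᵛ lincombᶠ ζ b) x        ≈⟨ f.cong x La+ζb≈0 ⟩
        f 0ᵛ x                                   ≈⟨ f.0-homo x ⟩
        0#                                       ∎

      b≈0 = tabulate-independent r (proj₁ (proj₂ r-basis)) b rb≈0

      La≈0 : lincomb L a ≈ᵛ 0ᵛ
      La≈0 x = begin
        lincomb L a x                    ≈⟨ +-identityʳ _ ⟨
        lincomb L a x + 0#               ≈⟨ +-congˡ (trans (ζ.cong x b≈0) (ζ.0-homo x)) ⟨
        lincomb L a x + lincombᶠ ζ b x   ≈⟨ La+ζb≈0 x ⟩
        0#                               ∎

    spans : ∀ v → K v → ∃₂ λ a b → v ≈ᵛ (lincomb L a +ᵛ lincombᶠ ζ b)
    spans v v∈K with b , fv≈rb ← tabulate-spans r (proj₂ (proj₂ r-basis)) (f v) (f[K]⊆W v∈K) =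
      a , b , λ x → begin
        v x                              ≈⟨ //-rightDividesˡ _ _ ⟨
        u x + lincombᶠ ζ b x             ≈⟨ +-congʳ (u≈La x) ⟩
        lincomb L a x + lincombᶠ ζ b x   ∎
      where
      u = v -ᵛ lincombᶠ ζ b

      fu≈0 : f u ≈ᵛ 0ᵛ
      fu≈0 x = begin
        f u x                             ≈⟨ f.-‿homo x v _ ⟩
        f v x - f (lincombᶠ ζ b) x        ≈⟨ +-cong (fv≈rb x) (-‿cong (f-lincombᶠ-ζ b x)) ⟩
        lincombᶠ r b x - lincombᶠ r b x   ≈⟨ -‿inverseʳ _ ⟩
        0#                                ∎

      a = proj₁ (L-spans u fu≈0)
      u≈La = proj₂ (L-spans u fu≈0)

    isBasis : IsBasisOf K (L ++ tabulate ζ)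
    isBasis = AllP.++⁺ (All.map ker⊆K L⊆ker) (AllP.tabulate⁺ ζ∈K) , ++-independent , ++-spans
      where
      ++-independent : LinIndep (L ++ tabulate ζ)
      ++-independent a La≈0 j with a₁ , a₂ , a≡join ← join-surjective L a =
        trans (reflexive (a≡join j)) (join-zero L a₁≈0 (tabulate-index-zero ζ b≈0) j)
        where
        split≈0 : (lincomb L a₁ +ᵛ lincombᶠ ζ (a₂ ∘ tabulate-index ζ)) ≈ᵛ 0ᵛ
        split≈0 x = begin
          lincomb L a₁ x + lincombᶠ ζ (a₂ ∘ tabulate-index ζ) x   ≈⟨ +-congˡ (lincomb-tabulate ζ a₂ x) ⟨
          lincomb L a₁ x + lincomb (tabulate ζ) a₂ x              ≈⟨ lincomb-++ L _ a₁ a₂ x ⟨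
          lincomb (L ++ tabulate ζ) (join L a₁ a₂) x              ≈⟨ lincomb-cong (L ++ _) (reflexive ∘ a≡join) x ⟨
          lincomb (L ++ tabulate ζ) a x                           ≈⟨ La≈0 x ⟩
          0#                                                      ∎

        a₁≈0 = proj₁ (independent a₁ _ split≈0)
        b≈0 = proj₂ (independent a₁ _ split≈0)

      ++-spans : Spans K (L ++ tabulate ζ)
      ++-spans v v∈K with a , b , v≈La+ζb ← spans v v∈K =
        join L a (b ∘ tabulate-index⁻¹ ζ) , λ x → begin
          v x                                                  ≈⟨ v≈La+ζb x ⟩
          lincomb L a x + lincombᶠ ζ b x                       ≈⟨ +-congˡ (lincombᶠ-as-tabulate ζ b x) ⟩
          lincomb L a x + lincomb (tabulate ζ) _ x             ≈⟨ lincomb-++ L _ a _ x ⟨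
          lincomb (L ++ tabulate ζ) (join L a (b ∘ tabulate-index⁻¹ ζ)) x ∎

  module UnitFamily {k p} {P : Fin k → Set p} (Z : Fin k → Vecᶠ k)
    (Z-unit : ∀ {e e′} → P e → P e′ → Z e e′ ≈ 𝟙 e e′)
    where

    private
      lincomb-off : ∀ {e es} → P e → All P es → All (e ≢_) es → ∀ a → lincomb (map Z es) a e ≈ 0#
      lincomb-off {e} Pe Pes e∉es = lincomb-vanishes-at e (AllP.map⁺ (All.zipWith Z-off (Pes , e∉es)))
        where
        Z-off : ∀ {e′} → P e′ × e ≢ e′ → Z e′ e ≈ 0#
        Z-off (Pe′ , e≢e′) = trans (Z-unit Pe′ Pe) (𝟙-off (e≢e′ ∘ ≡.sym))

      lincomb-at-head : ∀ {e es} → Unique (e ∷ es) → All P (e ∷ es) → ∀ a →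
                        lincomb (map Z (e ∷ es)) a e ≈ a zero
      lincomb-at-head {e} {es} (e∉es ∷ _) (Pe ∷ Pes) a = begin
        a zero * Z e e + lincomb (map Z es) (a ∘ suc) e
          ≈⟨ +-cong (*-congˡ (trans (Z-unit Pe Pe) (𝟙-diag e))) (lincomb-off Pe Pes e∉es _) ⟩
        a zero * 1# + 0#   ≈⟨ +-identityʳ _ ⟩
        a zero * 1#        ≈⟨ *-identityʳ _ ⟩
        a zero             ∎

    independent : ∀ {es} → Unique es → All P es → LinIndep (map Z es)
    independent {e ∷ es} u@(_ ∷ u-es) Pes@(_ ∷ Pes′) a Za≈0 = λ where
        zero    → a₀≈0
        (suc i) → independent u-es Pes′ (a ∘ suc) rest≈0 i
      where
      a₀≈0 : a zero ≈ 0#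
      a₀≈0 = trans (sym (lincomb-at-head u Pes a)) (Za≈0 e)

      rest≈0 : lincomb (map Z es) (a ∘ suc) ≈ᵛ 0ᵛ
      rest≈0 x = begin
        lincomb (map Z es) (a ∘ suc) x                    ≈⟨ +-identityˡ _ ⟨
        0# + lincomb (map Z es) (a ∘ suc) x               ≈⟨ +-congʳ (trans (*-congʳ a₀≈0) (zeroˡ _)) ⟨
        a zero * Z e x + lincomb (map Z es) (a ∘ suc) x   ≈⟨ Za≈0 x ⟩
        0#                                                ∎

    coordinates : (es : List (Fin k)) → Vecᶠ k → Vecᶠ (length (map Z es))
    coordinates (e ∷ es) u zero    = u e
    coordinates (e ∷ es) u (suc i) = coordinates es u i

    lincomb-coordinates : ∀ {es e} → Unique es → All P es → e ∈ₗ es → ∀ u →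
                          lincomb (map Z es) (coordinates es u) e ≈ u e
    lincomb-coordinates {es} u Pes (here ≡.refl) v = lincomb-at-head u Pes (coordinates es v)
    lincomb-coordinates {e₀ ∷ es} {e} (e₀∉es ∷ u-es) (Pe₀ ∷ Pes) (there e∈es) u = begin
      u e₀ * Z e₀ e + lincomb (map Z es) (coordinates es u) e
        ≈⟨ +-congʳ (*-congˡ (trans (Z-unit Pe₀ Pe) (𝟙-off e₀≢e))) ⟩
      u e₀ * 0# + lincomb (map Z es) (coordinates es u) e   ≈⟨ +-congʳ (zeroʳ _) ⟩
      0# + lincomb (map Z es) (coordinates es u) e          ≈⟨ +-identityˡ _ ⟩
      lincomb (map Z es) (coordinates es u) e               ≈⟨ lincomb-coordinates u-es Pes e∈es u ⟩
      u e                                                   ∎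
      where
      Pe = All.lookup Pes e∈es
      e₀≢e = All.lookup e₀∉es e∈es

length≤∣∣ : ∀ {n} {P : Subset n} {xs : List (Fin n)} → Unique xs → All (_∈ P) xs → length xs ≤ ∣ P ∣
length≤∣∣ {xs = []} _ _ = z≤n
length≤∣∣ {P = P} {x ∷ xs} (x∉xs ∷ u) (x∈P ∷ xs⊆P) =
  <-≤-trans (s≤s (length≤∣∣ u (All.zipWith xs⊆P-x (xs⊆P , x∉xs)))) (x∈p⇒∣p-x∣<∣p∣ x∈P)
  where
  xs⊆P-x : ∀ {y} → y ∈ P × x ≢ y → y ∈ P ∖ x
  xs⊆P-x (y∈P , x≢y) = x∈p∧x≢y⇒x∈p-y y∈P (x≢y ∘ ≡.sym)

module Walks (D : Digraph) where
  open Digraph D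
  open Graph D
  open import Data.Nat using (_+_)

  private
    module V = Data.List.Membership.DecPropositional (_≟_ {nV})
    module E = Data.List.Membership.DecPropositional (_≟_ {nE})

  data Step (e : Fin nE) : Fin nV → Fin nV → Set where
    forward  : Step e (s e) (t e)
    backward : Step e (t e) (s e)

  _◅_ : ∀ {e x y b} → Step e x y → Walk y b → Walk x b
  forward  ◅ w = fwd _ w
  backward ◅ w = bwd _ w

  Incident : Fin nV → Fin nE → Set
  Incident x e = x ≡ s e ⊎ x ≡ t e

  incident? : ∀ x e → Dec (Incident x e)
  incident? x e = (x ≟ s e) ⊎-dec (x ≟ t e)

  incident⇒step : ∀ {x e} → Incident x e → ∃ λ y → Step e y x
  incident⇒step (inj₁ ≡.refl) = _ , backward
  incident⇒step (inj₂ ≡.refl) = _ , forward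

  step⇒incident : ∀ {e x y} → Step e x y → Incident x e
  step⇒incident forward  = inj₁ ≡.refl
  step⇒incident backward = inj₂ ≡.refl

  start∈verts : ∀ {a b} (w : Walk a b) → a ∈ₗ verts w
  start∈verts []        = here ≡.refl
  start∈verts (fwd e w) = here ≡.refl
  start∈verts (bwd e w) = here ≡.refl

  incident∈verts : ∀ {x e a b} (w : Walk a b) → Incident x e → e ∈ₗ edges w → x ∈ₗ verts w
  incident∈verts (fwd e w) (inj₁ ≡.refl) (here ≡.refl) = here ≡.refl
  incident∈verts (fwd e w) (inj₂ ≡.refl) (here ≡.refl) = there (start∈verts w)
  incident∈verts (bwd e w) (inj₁ ≡.refl) (here ≡.refl) = there (start∈verts w)
  incident∈verts (bwd e w) (inj₂ ≡.refl) (here ≡.refl) = here ≡.refl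
  incident∈verts (fwd e w) x~e (there e∈w) = there (incident∈verts w x~e e∈w)
  incident∈verts (bwd e w) x~e (there e∈w) = there (incident∈verts w x~e e∈w)

  incident∉edges : ∀ {x e a b} (w : Walk a b) → x ∉ₗ verts w → Incident x e → e ∉ₗ edges w
  incident∉edges w x∉w x~e = x∉w ∘ incident∈verts w x~e

  unique-edges : ∀ {a b} (w : Walk a b) → Unique (verts w) → Unique (edges w)
  unique-edges []        _          = []
  unique-edges (fwd e w) (s∉w ∷ uw) =
    ¬Any⇒All¬ _ (incident∉edges w (All¬⇒¬Any s∉w) (inj₁ ≡.refl)) ∷ unique-edges w uw
  unique-edges (bwd e w) (t∉w ∷ uw) =
    ¬Any⇒All¬ _ (incident∉edges w (All¬⇒¬Any t∉w) (inj₂ ≡.refl)) ∷ unique-edges w uw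

  prefix : ∀ {a b c} (w : Walk a b) → c ∈ₗ verts w → Walk a c
  prefix []        (here ≡.refl) = []
  prefix (fwd e w) (here ≡.refl) = []
  prefix (bwd e w) (here ≡.refl) = []
  prefix (fwd e w) (there c∈w)   = fwd e (prefix w c∈w)
  prefix (bwd e w) (there c∈w)   = bwd e (prefix w c∈w)

  prefix-edges⊆ : ∀ {a b c} (w : Walk a b) (c∈w : c ∈ₗ verts w) {e} →
                  e ∈ₗ edges (prefix w c∈w) → e ∈ₗ edges w
  prefix-edges⊆ []        (here ≡.refl) ()
  prefix-edges⊆ (fwd e w) (here ≡.refl) ()
  prefix-edges⊆ (bwd e w) (here ≡.refl) ()
  prefix-edges⊆ (fwd e w) (there c∈w)   (here e≡) = here e≡
  prefix-edges⊆ (bwd e w) (there c∈w)   (here e≡) = here e≡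
  prefix-edges⊆ (fwd e w) (there c∈w)   (there e∈) = there (prefix-edges⊆ w c∈w e∈)
  prefix-edges⊆ (bwd e w) (there c∈w)   (there e∈) = there (prefix-edges⊆ w c∈w e∈)

  prefix-verts⊆ : ∀ {a b c} (w : Walk a b) (c∈w : c ∈ₗ verts w) {x} →
                  x ∈ₗ verts (prefix w c∈w) → x ∈ₗ verts w
  prefix-verts⊆ []        (here ≡.refl) x∈        = x∈
  prefix-verts⊆ (fwd e w) (here ≡.refl) (here x≡) = here x≡
  prefix-verts⊆ (bwd e w) (here ≡.refl) (here x≡) = here x≡
  prefix-verts⊆ (fwd e w) (there c∈w)   (here x≡) = here x≡
  prefix-verts⊆ (bwd e w) (there c∈w)   (here x≡) = here x≡
  prefix-verts⊆ (fwd e w) (there c∈w)   (there x∈) = there (prefix-verts⊆ w c∈w x∈)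
  prefix-verts⊆ (bwd e w) (there c∈w)   (there x∈) = there (prefix-verts⊆ w c∈w x∈)

  prefix-unique : ∀ {a b c} (w : Walk a b) (c∈w : c ∈ₗ verts w) →
                  Unique (verts w) → Unique (verts (prefix w c∈w))
  prefix-unique []        (here ≡.refl) _          = [] ∷ []
  prefix-unique (fwd e w) (here ≡.refl) _          = [] ∷ []
  prefix-unique (bwd e w) (here ≡.refl) _          = [] ∷ []
  prefix-unique (fwd e w) (there c∈w)   (a∉w ∷ uw) =
    AllP.anti-mono (prefix-verts⊆ w c∈w) a∉w ∷ prefix-unique w c∈w uw
  prefix-unique (bwd e w) (there c∈w)   (a∉w ∷ uw) =
    AllP.anti-mono (prefix-verts⊆ w c∈w) a∉w ∷ prefix-unique w c∈w uw

  acyclic-⊆ : ∀ {S S′ : Subset nE} → S′ ⊆ S → Acyclic S → Acyclic S′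
  acyclic-⊆ S′⊆S acyclic (a , w , w⊆S′ , w-cycle) = acyclic (a , w , All.map S′⊆S w⊆S′ , w-cycle)

  record Leaf (S : Subset nE) : Set where
    field
      {vertex neighbour} : Fin nV
      edge     : Fin nE
      edge∈S   : edge ∈ S
      step     : Step edge vertex neighbour
      not-loop : vertex ≢ neighbour
      isolated : ∀ {e} → e ∈ S → Incident vertex e → e ≡ edge

  module _ {S : Subset nE} where

    private
      closing-cycle : ∀ {e a c} → Step e c a → e ∈ S → (w : Walk a c) → InSub S w → e ∉ₗ edges w →
                      Unique (verts w) → ¬ Acyclic S
      closing-cycle forward  e∈S w w⊆S e∉w uw acyclic =
        acyclic (_ , fwd _ w , (e∈S ∷ w⊆S) , s≤s z≤n , (¬Any⇒All¬ _ e∉w ∷ unique-edges w uw) , uw)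
      closing-cycle backward e∈S w w⊆S e∉w uw acyclic =
        acyclic (_ , bwd _ w , (e∈S ∷ w⊆S) , s≤s z≤n , (¬Any⇒All¬ _ e∉w ∷ unique-edges w uw) , uw)

      extend : ∀ {e a b c} (st : Step e c a) (w : Walk a b) → e ∈ S → c ∉ₗ verts w → InSub S w →
               Unique (verts w) → InSub S (st ◅ w) × Unique (verts (st ◅ w))
      extend forward  w e∈S c∉w w⊆S uw = (e∈S ∷ w⊆S) , (¬Any⇒All¬ _ c∉w ∷ uw)
      extend backward w e∈S c∉w w⊆S uw = (e∈S ∷ w⊆S) , (¬Any⇒All¬ _ c∉w ∷ uw)

      extend-length : ∀ {e a b c} (st : Step e c a) (w : Walk a b) →
                      length (edges (st ◅ w)) ≡ suc (length (edges w))
      extend-length forward  w = ≡.refl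
      extend-length backward w = ≡.refl

      leaf-at-start : ∀ {a b} (w : Walk a b) → InSub S w → Unique (verts w) →
                      (∀ {e} → e ∈ S → Incident a e → e ∈ₗ edges w) →
                      ∃ (λ e → e ∈ S × Incident a e) → Leaf S
      leaf-at-start [] _ _ covered (_ , e∈S , a~e) with () ← covered e∈S a~e
      leaf-at-start (fwd g w) (g∈S ∷ _) (a∉w ∷ _) covered _ = record
        { edge∈S   = g∈S
        ; step     = forward
        ; not-loop = All.lookup a∉w (start∈verts w)
        ; isolated = λ e∈S a~e → Any.head (incident∉edges w (All¬⇒¬Any a∉w) a~e) (covered e∈S a~e)
        }
      leaf-at-start (bwd g w) (g∈S ∷ _) (a∉w ∷ _) covered _ = record
        { edge∈S   = g∈S
        ; step     = backward
        ; not-loop = All.lookup a∉w (start∈verts w)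
        ; isolated = λ e∈S a~e → Any.head (incident∉edges w (All¬⇒¬Any a∉w) a~e) (covered e∈S a~e)
        }

      -- w is a simple S-path from a. Prepend an unused S-edge at a while one exists: if its other
      -- end is already on w it closes a cycle, and otherwise w grows; fuel bounds the growth by ∣ S ∣.
      find-leaf : Acyclic S → (fuel : ℕ) → ∀ {a b} (w : Walk a b) → InSub S w → Unique (verts w) →
                  ∣ S ∣ < fuel + length (edges w) → ∃ (λ e → e ∈ S × Incident a e) → Leaf S
      find-leaf acyclic zero w w⊆S uw bound _ =
        contradiction (length≤∣∣ (unique-edges w uw) w⊆S) (<⇒≱ bound)
      find-leaf acyclic (suc fuel) {a} w w⊆S uw bound a-incident
        with any? (λ e → (e ∈? S) ×-dec (e E.∉? edges w) ×-dec incident? a e)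
      ... | no ∄unused = leaf-at-start w w⊆S uw covered a-incident
        where
        covered : ∀ {e} → e ∈ S → Incident a e → e ∈ₗ edges w
        covered {e} e∈S a~e = decidable-stable (e E.∈? edges w) (λ e∉w → ∄unused (e , e∈S , e∉w , a~e))
      ... | yes (e , e∈S , e∉w , a~e) with c , st ← incident⇒step a~e | c V.∈? verts w
      ...   | yes c∈w = contradiction acyclic
                          (closing-cycle st e∈S (prefix w c∈w) (AllP.anti-mono (prefix-edges⊆ w c∈w) w⊆S)
                                         (e∉w ∘ prefix-edges⊆ w c∈w) (prefix-unique w c∈w uw))
      ...   | no c∉w =
                find-leaf acyclic fuel (st ◅ w) (proj₁ extended) (proj₂ extended) bound′
                          (e , e∈S , step⇒incident st)
        where
        extended = extend st w e∈S c∉w w⊆S uw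
        bound′ : ∣ S ∣ < fuel + length (edges (st ◅ w))
        bound′ = ≡.subst (∣ S ∣ <_) (≡.trans (≡.sym (+-suc fuel _)) (≡.cong (fuel +_) (≡.sym (extend-length st w))))
                         bound

    leaf : Acyclic S → ∀ {g} → g ∈ S → Leaf S
    leaf acyclic {g} g∈S =
      find-leaf acyclic (suc ∣ S ∣) ([] {s g}) [] ([] ∷ []) (m≤m+n (suc ∣ S ∣) 0) (g , g∈S , inj₁ ≡.refl)

module IncidenceMap {c ℓ} (F : Field c ℓ) (D : Digraph) where
  open Field F hiding (zero)
  open Linear F
  open LinearAlgebra F
  open OnGraph D
  open Graph D
  open Digraph D
  open Walks D
  open import Algebra.Properties.Ring ring using (-‿distribʳ-*)
  open import Algebra.Properties.AbelianGroup +-abelianGroup using (⁻¹-anti-homo‿-)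
  open import Algebra.Properties.Group +-group using (ε⁻¹≈ε; ⁻¹-involutive)
  open import Relation.Binary.Reasoning.Setoid setoid

  column : Fin nE → Vecᶠ nV
  column e = 𝟙 (t e) -ᵛ 𝟙 (s e)

  B-linear : IsLinearᵛ B
  B-linear = lincombᶠ-linear column

  module B x = IsLinear (B-linear x)

  B-𝟙 : ∀ e → B (𝟙 e) ≈ᵛ column e
  B-𝟙 e x = lincombᴹ-𝟙 (λ e′ → column e′ x) e

  private
    ∈≢∉ : ∀ {T : Subset nE} {g e} → g ∈ T → e ∉ T → g ≢ e
    ∈≢∉ g∈T e∉T ≡.refl = e∉T g∈T

    telescope : ∀ x y z → (y - x) + (z - y) ≈ z - x
    telescope x y z = begin
      (y - x) + (z - y)    ≈⟨ +-comm _ _ ⟩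
      (z - y) + (y - x)    ≈⟨ +-assoc z (- y) (y - x) ⟩
      z + (- y + (y - x))  ≈⟨ +-congˡ (+-assoc (- y) y (- x)) ⟨
      z + ((- y + y) - x)  ≈⟨ +-congˡ (+-congʳ (-‿inverseˡ y)) ⟩
      z + (0# - x)         ≈⟨ +-congˡ (+-identityˡ (- x)) ⟩
      z - x                ∎

  B-signedVec : ∀ {a b} (p : Walk a b) → B (signedVec p) ≈ᵛ (𝟙 b -ᵛ 𝟙 a)
  B-signedVec {a} [] x = trans (B.0-homo x) (sym (-‿inverseʳ (𝟙 a x)))
  B-signedVec {b = b} (fwd e p) x = begin
    B (𝟙 e +ᵛ signedVec p) x                         ≈⟨ B.+-homo x _ _ ⟩
    B (𝟙 e) x + B (signedVec p) x                    ≈⟨ +-cong (B-𝟙 e x) (B-signedVec p x) ⟩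
    column e x + (𝟙 b x - 𝟙 (t e) x)                 ≈⟨ telescope _ _ _ ⟩
    𝟙 b x - 𝟙 (s e) x                                ∎
  B-signedVec {b = b} (bwd e p) x = begin
    B (signedVec p -ᵛ 𝟙 e) x                         ≈⟨ B.-‿homo x _ _ ⟩
    B (signedVec p) x - B (𝟙 e) x                    ≈⟨ +-cong (B-signedVec p x) (-‿cong (B-𝟙 e x)) ⟩
    (𝟙 b x - 𝟙 (s e) x) - column e x                 ≈⟨ +-congˡ (⁻¹-anti-homo‿- _ _) ⟩
    (𝟙 b x - 𝟙 (s e) x) + (𝟙 (s e) x - 𝟙 (t e) x)   ≈⟨ +-comm _ _ ⟩
    (𝟙 (s e) x - 𝟙 (t e) x) + (𝟙 b x - 𝟙 (s e) x)   ≈⟨ telescope _ _ _ ⟩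
    𝟙 b x - 𝟙 (t e) x                                ∎

  signedVec-off : ∀ {T a b} (p : Walk a b) → InSub T p → ∀ {e} → e ∉ T → signedVec p e ≈ 0#
  signedVec-off []        _           e∉T = refl
  signedVec-off (fwd g p) (g∈T ∷ p⊆T) e∉T =
    trans (+-cong (𝟙-off (∈≢∉ g∈T e∉T)) (signedVec-off p p⊆T e∉T)) (+-identityʳ 0#)
  signedVec-off (bwd g p) (g∈T ∷ p⊆T) e∉T =
    trans (+-cong (signedVec-off p p⊆T e∉T) (-‿cong (𝟙-off (∈≢∉ g∈T e∉T)))) (-‿inverseʳ 0#)

  private
    column-off : ∀ {x e} → ¬ Incident x e → column e x ≈ 0#
    column-off x≁e =
      trans (+-cong (𝟙-off (x≁e ∘ inj₂ ∘ ≡.sym)) (-‿cong (𝟙-off (x≁e ∘ inj₁ ∘ ≡.sym)))) (-‿inverseʳ 0#)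

    column-at-step : ∀ {g x y} → Step g x y → x ≢ y → column g x ≈ - 1# ⊎ column g x ≈ 1#
    column-at-step forward  x≢y =
      inj₁ (trans (+-cong (𝟙-off (x≢y ∘ ≡.sym)) (-‿cong (𝟙-diag _))) (+-identityˡ _))
    column-at-step backward x≢y =
      inj₂ (trans (+-cong (𝟙-diag _) (-‿cong (𝟙-off (x≢y ∘ ≡.sym))))
                  (trans (+-congˡ ε⁻¹≈ε) (+-identityʳ 1#)))

    cancel-±1 : ∀ {w a} → a ≈ - 1# ⊎ a ≈ 1# → w * a ≈ 0# → w ≈ 0#
    cancel-±1 {w} {a} (inj₁ a≈-1) wa≈0 = begin
      w              ≈⟨ ⁻¹-involutive w ⟨
      - (- w)        ≈⟨ -‿cong (-‿cong (*-identityʳ w)) ⟨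
      - (- (w * 1#)) ≈⟨ -‿cong (-‿distribʳ-* w 1#) ⟩
      - (w * - 1#)   ≈⟨ -‿cong (*-congˡ a≈-1) ⟨
      - (w * a)      ≈⟨ -‿cong wa≈0 ⟩
      - 0#           ≈⟨ ε⁻¹≈ε ⟩
      0#             ∎
    cancel-±1 {w} (inj₂ a≈1) wa≈0 = trans (sym (trans (*-congˡ a≈1) (*-identityʳ w))) wa≈0

  module _ {w : Vecᶠ nE} (Bw≈0 : B w ≈ᵛ 0ᵛ) where

    private
      leaf-edge-vanishes : ∀ {S} → (∀ e → e ∉ S → w e ≈ 0#) → (l : Leaf S) → w (Leaf.edge l) ≈ 0#
      leaf-edge-vanishes {S} w⊆S l = cancel-±1 (column-at-step step not-loop) (begin
        w edge * column edge vertex  ≈⟨ Σ-single _ edge others-vanish ⟨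
        B w vertex                   ≈⟨ Bw≈0 vertex ⟩
        0#                           ∎)
        where
        open Leaf l
        others-vanish : ∀ e → e ≢ edge → w e * column e vertex ≈ 0#
        others-vanish e e≢edge with e ∈? S
        ... | yes e∈S = trans (*-congˡ (column-off (e≢edge ∘ isolated e∈S))) (zeroʳ _)
        ... | no e∉S  = trans (*-congʳ (w⊆S e e∉S)) (zeroˡ _)

      peel-leaves : ∀ fuel {S} → ∣ S ∣ ≤ fuel → Acyclic S → (∀ e → e ∉ S → w e ≈ 0#) → ∀ e → w e ≈ 0#
      peel-leaves zero size _ w⊆S e = w⊆S e (λ e∈S → n≮0 (<-≤-trans (x∈p⇒∣p-x∣<∣p∣ e∈S) size))
      peel-leaves (suc fuel) {S} size acyclic w⊆S with any? (_∈? S)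
      ... | no S-empty     = λ e → w⊆S e (λ e∈S → S-empty (e , e∈S))
      ... | yes (_ , g∈S) =
        peel-leaves fuel (≤-pred (<-≤-trans (x∈p⇒∣p-x∣<∣p∣ edge∈S) size))
                    (acyclic-⊆ (p─q⊆p S ⁅ edge ⁆) acyclic) w⊆S∖edge
        where
        l = leaf acyclic g∈S
        open Leaf l
        w⊆S∖edge : ∀ e → e ∉ S ∖ edge → w e ≈ 0#
        w⊆S∖edge e e∉S∖edge with e ≟ edge
        ... | yes ≡.refl = leaf-edge-vanishes w⊆S l
        ... | no e≢edge  = w⊆S e (e∉S∖edge ∘ (λ e∈S → x∈p∧x≢y⇒x∈p-y e∈S e≢edge))

    acyclic-kernel : ∀ {S} → Acyclic S → (∀ e → e ∉ S → w e ≈ 0#) → ∀ e → w e ≈ 0#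
    acyclic-kernel {S} = peel-leaves ∣ S ∣ ≤-refl

module FundamentalCycles {c ℓ} (F : Field c ℓ) (D : Digraph) {T : Subset (Digraph.nE D)} where
  open Field F hiding (zero)
  open Linear F
  open LinearAlgebra F
  open OnGraph D
  open Graph D
  open Digraph D
  open IncidenceMap F D
  open import Algebra.Properties.Group +-group using (ε⁻¹≈ε; x∙y⁻¹≈ε⇒x≈y)
  open import Relation.Binary.Reasoning.Setoid setoid

  nonTree : List (Fin nE)
  nonTree = filter (λ e → ¬? (e ∈? T)) (allFin nE)

  private
    nonTree-unique : Unique nonTree
    nonTree-unique = Unique.filter⁺ _ (Unique.allFin⁺ nE)

    nonTree⊆∁T : All (_∉ T) nonTree
    nonTree⊆∁T = AllP.all-filter _ (allFin nE)

    ∁T⊆nonTree : ∀ {e} → e ∉ T → e ∈ₗ nonTree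
    ∁T⊆nonTree = ∈-filter⁺ _ (∈-allFin _)

  module _ (T-acyclic : Acyclic T) {Z : Fin nE → Vecᶠ nE} (Z-top : IsZtop T Z) where

    B-Z : ∀ {e} → e ∉ T → B (Z e) ≈ᵛ 0ᵛ
    B-Z {e} e∉T x with p , _ , _ , Z≈ ← Z-top e e∉T = begin
      B (Z e) x                       ≈⟨ B.cong x Z≈ ⟩
      B (𝟙 e -ᵛ signedVec p) x        ≈⟨ B.-‿homo x _ _ ⟩
      B (𝟙 e) x - B (signedVec p) x   ≈⟨ +-cong (B-𝟙 e x) (-‿cong (B-signedVec p x)) ⟩
      column e x - column e x         ≈⟨ -‿inverseʳ _ ⟩
      0#                              ∎

    Z-unit : ∀ {e e′} → e ∉ T → e′ ∉ T → Z e e′ ≈ 𝟙 e e′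
    Z-unit {e} {e′} e∉T e′∉T with p , p⊆T , _ , Z≈ ← Z-top e e∉T = begin
      Z e e′                    ≈⟨ Z≈ e′ ⟩
      𝟙 e e′ - signedVec p e′   ≈⟨ +-congˡ (-‿cong (signedVec-off p p⊆T e′∉T)) ⟩
      𝟙 e e′ - 0#               ≈⟨ +-congˡ ε⁻¹≈ε ⟩
      𝟙 e e′ + 0#               ≈⟨ +-identityʳ _ ⟩
      𝟙 e e′                    ∎

    open UnitFamily Z Z-unit

    isBasis : IsBasisOf (λ v → B v ≈ᵛ 0ᵛ) (map Z nonTree)
    isBasis = Z⊆kerB , independent nonTree-unique nonTree⊆∁T , spans
      where
      Z⊆kerB : All (λ v → B v ≈ᵛ 0ᵛ) (map Z nonTree)
      Z⊆kerB = AllP.map⁺ (All.map B-Z nonTree⊆∁T)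

      spans : Spans (λ v → B v ≈ᵛ 0ᵛ) (map Z nonTree)
      spans v Bv≈0 = a , λ x → x∙y⁻¹≈ε⇒x≈y _ _ (acyclic-kernel B[v-Za]≈0 T-acyclic v-Za-off-T x)
        where
        a = coordinates nonTree v

        B[v-Za]≈0 : B (v -ᵛ lincomb (map Z nonTree) a) ≈ᵛ 0ᵛ
        B[v-Za]≈0 x = begin
          B (v -ᵛ lincomb (map Z nonTree) a) x      ≈⟨ B.-‿homo x _ _ ⟩
          B v x - B (lincomb (map Z nonTree) a) x
            ≈⟨ +-cong (Bv≈0 x) (-‿cong (lincomb-∈-kernel B-linear Z⊆kerB a x)) ⟩
          0# - 0#                                   ≈⟨ -‿inverseʳ 0# ⟩
          0#                                        ∎

        v-Za-off-T : ∀ e → e ∉ T → v e - lincomb (map Z nonTree) a e ≈ 0#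
        v-Za-off-T e e∉T =
          trans (+-congˡ (-‿cong (lincomb-coordinates nonTree-unique nonTree⊆∁T (∁T⊆nonTree e∉T) v)))
                (-‿inverseʳ (v e))

module BoundaryMap {c ℓ} (F : Field c ℓ) (D : Digraph) {m ℓm}
  (U : Module (Field.commutativeRing F) m ℓm) (φ : Fin (Digraph.nV D) → Module.Carrierᴹ U) where
  open Field F hiding (zero)
  open Linear F
  open Coordinates F using (lincombᶠ)
  open OnGraph D
  open WithU U
  open Digraph D
  open IncidenceMap F D using (column)
  open Module U
  open import Relation.Binary.Reasoning.Setoid ≈ᴹ-setoid

  module Uᶜ = Combinations F U ΣU[_] (λ _ → ≡.refl) (λ _ → ≡.refl)

  φ̂-linear : Uᶜ.IsLinear (φ̂ φ)
  φ̂-linear = Uᶜ.lincombᴹ-linear φ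

  private
    module φ̂ = Uᶜ.IsLinear φ̂-linear

  φ̂-column : ∀ e → φ̂ φ (column e) ≈ᴹ φ (t e) +ᴹ -ᴹ φ (s e)
  φ̂-column e =
    ≈ᴹ-trans (φ̂.-‿homo _ _) (+ᴹ-cong (Uᶜ.lincombᴹ-𝟙 φ (t e)) (-ᴹ‿cong (Uᶜ.lincombᴹ-𝟙 φ (s e))))

  φ̂∘B≈∂ : ∀ z → φ̂ φ (B z) ≈ᴹ ∂ φ z
  φ̂∘B≈∂ z = begin
    φ̂ φ (lincombᶠ column z)                ≈⟨ φ̂.lincombᶠ-homo column z ⟩
    Uᶜ.lincombᴹ (λ e → φ̂ φ (column e)) z   ≈⟨ Uᶜ.Σ-cong (λ e → *ₗ-congˡ (φ̂-column e)) ⟩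
    ∂ φ z                                  ∎

  Ker∂⇒Zalg : ∀ {z} → Ker∂ φ z → Zalg φ (B z)
  Ker∂⇒Zalg {z} ∂z≈0 = (z , λ _ → refl) , ≈ᴹ-trans (φ̂∘B≈∂ z) ∂z≈0

  kerB⊆Ker∂ : ∀ {z} → B z ≈ᵛ 0ᵛ → Ker∂ φ z
  kerB⊆Ker∂ {z} Bz≈0 = begin
    ∂ φ z       ≈⟨ φ̂∘B≈∂ z ⟨
    φ̂ φ (B z)   ≈⟨ φ̂.cong Bz≈0 ⟩
    φ̂ φ 0ᵛ      ≈⟨ φ̂.0-homo ⟩
    0ᴹ          ∎

theorem2p15 : ∀ {c ℓ m ℓm : Level} (F : Field c ℓ) (D : Digraph)
  (U : Module (Field.commutativeRing F) m ℓm)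
  (φ : Fin (Digraph.nV D) → Module.Carrierᴹ U)
  (T : Subset (Digraph.nE D)) →
  let open Linear F
      open OnGraph D
      open WithU U
      open Graph D
      open Digraph D
  in IsSpanningForest T →
     (δ : ℕ) (r : Fin δ → Vecᶠ nV) →
     IsBasisOf (Zalg φ) (tabulate r) →
     (ζ : Fin δ → Vecᶠ nE) →
     (∀ i → Ker∂ φ (ζ i)) →
     (∀ i → B (ζ i) ≈ᵛ r i) →
     (Z : Fin nE → Vecᶠ nE) →
     IsZtop T Z →
     IsBasisOf (Ker∂ φ)
       (map Z (filter (λ e → ¬? (e ∈? T)) (allFin nE)) ++ tabulate ζ)
theorem2p15 F D U φ T (T-acyclic , _) δ r r-basis ζ ζ∈Ker∂ Bζ≈r Z Z-top =
  KernelExtension.isBasis B-linear Ker∂⇒Zalg kerB⊆Ker∂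
    (FundamentalCycles.isBasis F D T-acyclic Z-top) r-basis ζ∈Ker∂ Bζ≈r
  where
  open LinearAlgebra F
  open IncidenceMap F D
  open BoundaryMap F D U φ
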